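{- Let $n$ be a positive integer and $d\in\Delta(n)$, written as $d=\big(1,2,\dots,q-1,q,q^{(s_q)},(q-1)^{(s_{q-1})},\dots,1^{(s_1)}\big)$ with integers $q>0$, $s_1,\dots,s_q\ge 0$. Let $\overline{\alpha}=(\overline{\alpha}_1,\dots,\overline{\alpha}_q)$ with $\overline{\alpha}_i=q-i+1+\sum_{k=i}^{q}s_k$, and let $\underline{\alpha}=\overline{\alpha}^*$ be its conjugate. Then for every $\alpha\in\mathcal{P}(n)$ with $\delta(\alpha)=d$ we have $\overline{\alpha}\succ\alpha\succ\underline{\alpha}$.
   Context: $\mathcal{P}(n)$ is the set of partitions $\alpha=(\alpha_1\ge\dots\ge\alpha_t\ge1)$ of $n$, with $\alpha_i=0$ for $i>t$. The diagonal sequence of $\alpha$ is $\delta(\alpha)=(d_k)_{k\ge1}$, $d_k=\big|\{i:1\le i\le k,\ \alpha_i+i-1\ge k\}\big|$; trailing zeros are omitted; $\Delta(n)=\{\delta(\alpha):\alpha\in\mathcal{P}(n)\}$. The notation $m^{(s)}$ means $s$ consecutive entries equal to $m$ (none if $s=0$). Every element of $\Delta(n)$ can be written in the displayed form. $\alpha^*$ denotes the conjugate partition. For $\alpha,\beta\in\mathcal{P}(n)$, $\alpha\succ\beta$ ($\alpha$ majorizes $\beta$) means $\sum_{i=1}^k\alpha_i\ge\sum_{i=1}^k\beta_i$ for all $k$ up to the minimum of the numbers of parts of $\alpha$ and $\beta$. -}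

module Defs where

open import Data.Nat using (ℕ; zero; suc; _+_; _∸_; _≤_; _≤?_; _⊔_; _⊓_)
open import Data.Nat.Properties using (_≟_)
open import Data.List using (List; []; _∷_; map; filter; length; take; upTo; reverse; dropWhile; replicate; concatMap; _++_)
open import Data.Nat.ListAction using (sum)
open import Data.List.Relation.Unary.All using (All)
open import Data.List.Relation.Unary.Linked using (Linked)
open import Data.Nat using (_≥_)
open import Data.Product using (Σ; _×_)
open import Relation.Binary.PropositionalEquality using (_≡_)

-- α_i, 1-indexed, 0 outside the list (α_i = 0 for i > t, and for i = 0)
at : List ℕ → ℕ → ℕ
at []       _             = 0
at (x ∷ xs) zero          = 0
at (x ∷ xs) (suc zero)    = x
at (x ∷ xs) (suc (suc i)) = at xs (suc i)

range1 : ℕ → List ℕ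
range1 m = map suc (upTo m)

IsPartition : ℕ → List ℕ → Set
IsPartition n α = Linked _≥_ α × All (1 ≤_) α × sum α ≡ n

diag : List ℕ → ℕ → ℕ
diag α k = length (filter (λ i → k ≤? at α i + i ∸ 1) (range1 k))

stripZeros : List ℕ → List ℕ
stripZeros xs = reverse (dropWhile (λ x → x ≟ 0) (reverse xs))

-- δ(α) = (d_k)_{k ≥ 1} with trailing zeros omitted.
-- d_k = 0 for all k > |α| (= n), so it suffices to list d_1, ..., d_{|α|}.
δ : List ℕ → List ℕ
δ α = stripZeros (map (diag α) (range1 (sum α)))

_∈Δ_ : List ℕ → ℕ → Set
d ∈Δ n = Σ (List ℕ) (λ β → IsPartition n β × δ β ≡ d)

diagForm : ℕ → (ℕ → ℕ) → List ℕ
diagForm q s = range1 q ++ concatMap (λ j → replicate (s j) j) (reverse (range1 q))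

alphaBar : ℕ → (ℕ → ℕ) → List ℕ
alphaBar q s = map (λ i → q ∸ i + 1 + sum (map s (filter (λ k → i ≤? k) (range1 q)))) (range1 q)

conj : List ℕ → List ℕ
conj α = map (λ j → length (filter (λ x → j ≤? x) α)) (range1 (at α 1))

_≻_ : List ℕ → List ℕ → Set
α ≻ β = ∀ k → k ≤ length α ⊓ length β → sum (take k β) ≤ sum (take k α)

-- Cell (i, c) of the diagram of α lies on diagonal i + c − 1, and d_m counts the rows i ≤ m
-- meeting diagonal m. On that diagonal the first k rows own at most min(k, d_m) cells and, since
-- only rows k+1, …, m can be missing, at least d_m − (m − k)⁺ cells. Summing over m, the size
-- α_1 + ⋯ + α_k of the first k rows lies between Σ_m (d_m − (m − k)⁺) and Σ_m min(k, d_m).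
-- For d of the given shape, j ≤ d_m holds exactly for j ≤ m ≤ q + s_j + ⋯ + s_q, so counting
-- column by column turns the upper sum into ᾱ_1 + ⋯ + ᾱ_k and the lower one into
-- Σ_j min(k, ᾱ_j) = ᾱ*_1 + ⋯ + ᾱ*_k.
module Submission where

open import Defs
open import Data.Nat
open import Data.Nat.Properties
open import Data.List using (List; []; _∷_; map; filter; length; take; upTo; reverse; dropWhile; replicate; concatMap; _++_; _∷ʳ_)
open import Data.List.Properties
  using ( map-cong; map-++; map-∘; length-map; length-++; length-upTo; length-replicate; applyUpTo-∷ʳ; take-all
        ; unfold-reverse; reverse-++; reverse-involutive)
open import Data.Nat.ListAction using (sum)
open import Data.Nat.ListAction.Properties using (sum-++)
open import Data.List.Relation.Unary.All using (All; []; _∷_)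
open import Data.Product using (_×_; _,_; proj₁; proj₂; Σ)
open import Relation.Nullary using (Dec; yes; no; ¬_)
open import Relation.Unary using (Pred; Decidable)
open import Relation.Binary.PropositionalEquality
open import Data.Empty using (⊥-elim)
open import Function.Bundles using (_⇔_; mk⇔; Equivalence)
open Equivalence using (to; from)
open import Function.Base using (_∘_)
open import Algebra.Properties.CommutativeSemigroup +-commutativeSemigroup using () renaming (interchange to +-interchange)
open import Algebra.Properties.CommutativeSemigroup *-commutativeSemigroup using () renaming (x∙yz≈y∙xz to x*[y*z]≡y*[x*z])

∑ : (ℕ → ℕ) → ℕ → ℕ
∑ f zero    = 0
∑ f (suc n) = ∑ f n + f (suc n)

∑-cong : ∀ n {f g : ℕ → ℕ} → (∀ i → 1 ≤ i → i ≤ n → f i ≡ g i) → ∑ f n ≡ ∑ g n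
∑-cong zero    eq = refl
∑-cong (suc n) eq = cong₂ _+_ (∑-cong n (λ i i≥1 i≤n → eq i i≥1 (m≤n⇒m≤1+n i≤n))) (eq (suc n) (s≤s z≤n) ≤-refl)

∑-mono-≤ : ∀ n {f g : ℕ → ℕ} → (∀ i → 1 ≤ i → i ≤ n → f i ≤ g i) → ∑ f n ≤ ∑ g n
∑-mono-≤ zero    le = z≤n
∑-mono-≤ (suc n) le = +-mono-≤ (∑-mono-≤ n (λ i i≥1 i≤n → le i i≥1 (m≤n⇒m≤1+n i≤n))) (le (suc n) (s≤s z≤n) ≤-refl)

∑-zero : ∀ n → ∑ (λ _ → 0) n ≡ 0
∑-zero zero    = refl
∑-zero (suc n) = trans (+-identityʳ _) (∑-zero n)

∑-vanishes : ∀ n {f : ℕ → ℕ} → (∀ i → 1 ≤ i → i ≤ n → f i ≡ 0) → ∑ f n ≡ 0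
∑-vanishes n eq = trans (∑-cong n eq) (∑-zero n)

∑-distrib-+ : ∀ n (f g : ℕ → ℕ) → ∑ (λ i → f i + g i) n ≡ ∑ f n + ∑ g n
∑-distrib-+ zero    f g = refl
∑-distrib-+ (suc n) f g =
  trans (cong (_+ (f (suc n) + g (suc n))) (∑-distrib-+ n f g)) (+-interchange (∑ f n) (∑ g n) (f (suc n)) (g (suc n)))

∑-distribˡ-* : ∀ n c (f : ℕ → ℕ) → ∑ (λ i → c * f i) n ≡ c * ∑ f n
∑-distribˡ-* zero    c f = sym (*-zeroʳ c)
∑-distribˡ-* (suc n) c f =
  trans (cong (_+ c * f (suc n)) (∑-distribˡ-* n c f)) (sym (*-distribˡ-+ c (∑ f n) (f (suc n))))

∑-comm : ∀ n m (h : ℕ → ℕ → ℕ) → ∑ (λ i → ∑ (h i) m) n ≡ ∑ (λ j → ∑ (λ i → h i j) n) m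
∑-comm zero    m h = sym (∑-zero m)
∑-comm (suc n) m h = trans (cong (_+ ∑ (h (suc n)) m) (∑-comm n m h))
  (sym (∑-distrib-+ m (λ j → ∑ (λ i → h i j) n) (h (suc n))))

∑-+ : ∀ a b (f : ℕ → ℕ) → ∑ f (a + b) ≡ ∑ f a + ∑ (λ t → f (a + t)) b
∑-+ a zero    f = trans (cong (∑ f) (+-identityʳ a)) (sym (+-identityʳ _))
∑-+ a (suc b) f rewrite +-suc a b = trans (cong (_+ f (suc (a + b))) (∑-+ a b f)) (+-assoc (∑ f a) _ _)

∑-monoʳ-≤ : ∀ {n N} (f : ℕ → ℕ) → n ≤ N → ∑ f n ≤ ∑ f N
∑-monoʳ-≤ {n} f n≤N = subst (λ N → ∑ f n ≤ ∑ f N) (m+[n∸m]≡n n≤N)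
  (subst (∑ f n ≤_) (sym (∑-+ n _ f)) (m≤m+n _ _))

n≤∑ : ∀ n (f : ℕ → ℕ) → (∀ i → 1 ≤ i → i ≤ n → 1 ≤ f i) → n ≤ ∑ f n
n≤∑ n f f≥1 = subst (_≤ ∑ f n) (∑-const-1 n) (∑-mono-≤ n f≥1)
  where
  ∑-const-1 : ∀ n → ∑ (λ _ → 1) n ≡ n
  ∑-const-1 zero    = refl
  ∑-const-1 (suc n) = trans (cong (_+ 1) (∑-const-1 n)) (+-comm n 1)

∑-sum-map : ∀ k (f : ℕ → ℕ → ℕ) xs → ∑ (λ i → sum (map (f i) xs)) k ≡ sum (map (λ x → ∑ (λ i → f i x) k) xs)
∑-sum-map k f []       = ∑-zero k
∑-sum-map k f (x ∷ xs) = trans (∑-distrib-+ k (λ i → f i x) (λ i → sum (map (f i) xs)))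
                               (cong (∑ (λ i → f i x) k +_) (∑-sum-map k f xs))

χ : {P : Set} → Dec P → ℕ
χ (yes _) = 1
χ (no _)  = 0

χ-yes : {P : Set} (d : Dec P) → P → χ d ≡ 1
χ-yes (yes _) p = refl
χ-yes (no ¬p) p = ⊥-elim (¬p p)

χ-no : {P : Set} (d : Dec P) → ¬ P → χ d ≡ 0
χ-no (yes p) ¬p = ⊥-elim (¬p p)
χ-no (no _)  ¬p = refl

χ≤1 : {P : Set} (d : Dec P) → χ d ≤ 1
χ≤1 (yes _) = s≤s z≤n
χ≤1 (no _)  = z≤n

χ-cong : {P Q : Set} (d : Dec P) (e : Dec Q) → P ⇔ Q → χ d ≡ χ e
χ-cong (yes p) e P⇔Q = sym (χ-yes e (to P⇔Q p))
χ-cong (no ¬p) e P⇔Q = sym (χ-no e (λ q → ¬p (from P⇔Q q)))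

χ*n≤n : {P : Set} (d : Dec P) (n : ℕ) → χ d * n ≤ n
χ*n≤n (yes _) n = ≤-reflexive (+-identityʳ n)
χ*n≤n (no _)  n = z≤n

χ-≤-⊓ : ∀ m x y → χ (m ≤? x) * χ (m ≤? y) ≡ χ (m ≤? x ⊓ y)
χ-≤-⊓ m x y with m ≤? x | m ≤? y
... | yes p | yes q = sym (χ-yes (m ≤? x ⊓ y) (⊓-glb p q))
... | yes p | no ¬q = sym (χ-no (m ≤? x ⊓ y) (λ r → ¬q (≤-trans r (m⊓n≤n x y))))
... | no ¬p | _     = sym (χ-no (m ≤? x ⊓ y) (λ r → ¬p (≤-trans r (m⊓n≤m x y))))

∑-χ-≤ : ∀ k b → ∑ (λ j → χ (j ≤? b)) k ≡ k ⊓ b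
∑-χ-≤ zero    b = refl
∑-χ-≤ (suc k) b with suc k ≤? b
... | yes k<b = trans (cong (_+ 1) (trans (∑-χ-≤ k b) (m≤n⇒m⊓n≡m (<⇒≤ k<b))))
                      (trans (+-comm k 1) (sym (m≤n⇒m⊓n≡m k<b)))
... | no k≮b  = trans (+-identityʳ _) (trans (∑-χ-≤ k b)
                  (trans (m≥n⇒m⊓n≡n b≤k) (sym (m≥n⇒m⊓n≡n (m≤n⇒m≤1+n b≤k)))))
  where
  b≤k : b ≤ k
  b≤k = ≤-pred (≰⇒> k≮b)

∑-χ-> : ∀ a b → ∑ (λ m → χ (suc a ≤? m)) b ≡ b ∸ a
∑-χ-> a zero    = sym (0∸n≡0 a)
∑-χ-> a (suc b) with suc a ≤? suc b
... | yes (s≤s a≤b) = trans (cong (_+ 1) (∑-χ-> a b)) (trans (sym (+-∸-comm 1 a≤b)) (cong (_∸ a) (+-comm b 1)))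
... | no a≮b        = trans (+-identityʳ _) (trans (∑-χ-> a b)
                        (trans (m≤n⇒m∸n≡0 (≤-trans (n≤1+n b) b<a)) (sym (m≤n⇒m∸n≡0 b<a))))
  where
  b<a : suc b ≤ a
  b<a = ≤-pred (≰⇒> a≮b)

∑-restrict : ∀ m N (g : ℕ → ℕ) → m ≤ N → ∑ (λ i → χ (i ≤? m) * g i) N ≡ ∑ g m
∑-restrict m N g m≤N = begin
  ∑ h N                                  ≡⟨ cong (∑ h) (sym (m+[n∸m]≡n m≤N)) ⟩
  ∑ h (m + (N ∸ m))                      ≡⟨ ∑-+ m (N ∸ m) h ⟩
  ∑ h m + ∑ (λ t → h (m + t)) (N ∸ m)   ≡⟨ cong₂ _+_ inside outside ⟩
  ∑ g m + 0                              ≡⟨ +-identityʳ _ ⟩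
  ∑ g m                                  ∎
  where
  open ≡-Reasoning
  h : ℕ → ℕ
  h i = χ (i ≤? m) * g i
  inside : ∑ h m ≡ ∑ g m
  inside = ∑-cong m (λ i _ i≤m → trans (cong (_* g i) (χ-yes (i ≤? m) i≤m)) (+-identityʳ _))
  outside : ∑ (λ t → h (m + t)) (N ∸ m) ≡ 0
  outside = ∑-vanishes (N ∸ m) (λ t t≥1 _ → cong (_* g (m + t)) (χ-no (m + t ≤? m) (<⇒≱ (m<m+n m t≥1))))

∑-χ-interval : ∀ a b N → 1 ≤ a → b ≤ N → ∑ (λ m → χ (a ≤? m) * χ (m ≤? b)) N ≡ suc b ∸ a
∑-χ-interval (suc a) b N _ b≤N = begin
  ∑ (λ m → χ (suc a ≤? m) * χ (m ≤? b)) N ≡⟨ ∑-cong N (λ m _ _ → *-comm (χ (suc a ≤? m)) _) ⟩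
  ∑ (λ m → χ (m ≤? b) * χ (suc a ≤? m)) N ≡⟨ ∑-restrict b N (λ m → χ (suc a ≤? m)) b≤N ⟩
  ∑ (λ m → χ (suc a ≤? m)) b             ≡⟨ ∑-χ-> a b ⟩
  b ∸ a                                  ∎
  where open ≡-Reasoning

m∸k≤j⇔m≤j+k : ∀ m k j → m ∸ k ≤ j ⇔ m ≤ j + k
m∸k≤j⇔m≤j+k m k j = mk⇔
  (λ m∸k≤j → ≤-trans (m≤n+m∸n m k) (subst (k + (m ∸ k) ≤_) (+-comm k j) (+-monoʳ-≤ k m∸k≤j)))
  (λ m≤j+k → m≤n+o⇒m∸n≤o m k (subst (m ≤_) (+-comm j k) m≤j+k))

suc[m+n]∸o≡m∸o+1+n : ∀ m n o → o ≤ m → suc (m + n) ∸ o ≡ m ∸ o + 1 + n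
suc[m+n]∸o≡m∸o+1+n m n o o≤m =
  trans (cong (_∸ o) (sym (+-suc m n))) (trans (+-∸-comm (suc n) o≤m) (sym (+-assoc (m ∸ o) 1 n)))

∑-χ-window : ∀ j k b N → b ≤ N →
  ∑ (λ m → χ (suc (m ∸ k) ≤? suc j) * (χ (suc j ≤? m) * χ (m ≤? b))) N ≡ k ⊓ (b ∸ j)
∑-χ-window j k b N b≤N = begin
  ∑ (λ m → χ (suc (m ∸ k) ≤? suc j) * (χ (suc j ≤? m) * χ (m ≤? b))) N ≡⟨ ∑-cong N (λ m _ _ → merge m) ⟩
  ∑ (λ m → χ (suc j ≤? m) * χ (m ≤? (j + k) ⊓ b)) N                  ≡⟨ ∑-χ-interval (suc j) ((j + k) ⊓ b) N (s≤s z≤n)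
                                                                          (≤-trans (m⊓n≤n (j + k) b) b≤N) ⟩
  (j + k) ⊓ b ∸ j                                                     ≡⟨ ∸-distribʳ-⊓ j (j + k) b ⟩
  (j + k ∸ j) ⊓ (b ∸ j)                                               ≡⟨ cong (_⊓ (b ∸ j)) (m+n∸m≡n j k) ⟩
  k ⊓ (b ∸ j)                                                         ∎
  where
  open ≡-Reasoning
  merge : ∀ m → χ (suc (m ∸ k) ≤? suc j) * (χ (suc j ≤? m) * χ (m ≤? b)) ≡ χ (suc j ≤? m) * χ (m ≤? (j + k) ⊓ b)
  merge m = begin
    χ (suc (m ∸ k) ≤? suc j) * (χ (suc j ≤? m) * χ (m ≤? b))
      ≡⟨ cong (_* (χ (suc j ≤? m) * χ (m ≤? b))) (χ-cong (suc (m ∸ k) ≤? suc j) (m ≤? j + k) within) ⟩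
    χ (m ≤? j + k) * (χ (suc j ≤? m) * χ (m ≤? b))
      ≡⟨ x*[y*z]≡y*[x*z] (χ (m ≤? j + k)) (χ (suc j ≤? m)) (χ (m ≤? b)) ⟩
    χ (suc j ≤? m) * (χ (m ≤? j + k) * χ (m ≤? b))
      ≡⟨ cong (χ (suc j ≤? m) *_) (χ-≤-⊓ m (j + k) b) ⟩
    χ (suc j ≤? m) * χ (m ≤? (j + k) ⊓ b)
      ∎
    where
    within : suc (m ∸ k) ≤ suc j ⇔ m ≤ j + k
    within = mk⇔ (to (m∸k≤j⇔m≤j+k m k j) ∘ s≤s⁻¹) (s≤s ∘ from (m∸k≤j⇔m≤j+k m k j))

≰⇒≡+nonzero : ∀ {t r} → ¬ t ≤ r → Σ ℕ λ u → t ≡ r + u × 1 ≤ u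
≰⇒≡+nonzero {t} {r} t≰r = t ∸ r , sym (m+[n∸m]≡n (<⇒≤ (≰⇒> t≰r))) , m<n⇒0<n∸m (≰⇒> t≰r)

at-zero : ∀ xs → at xs 0 ≡ 0
at-zero []       = refl
at-zero (x ∷ xs) = refl

at-suc : ∀ x xs p → 1 ≤ p → at (x ∷ xs) (suc p) ≡ at xs p
at-suc x xs (suc p) _ = refl

at-++ˡ : ∀ xs ys m → m ≤ length xs → at (xs ++ ys) m ≡ at xs m
at-++ˡ []       ys zero          _         = at-zero ys
at-++ˡ (x ∷ xs) ys zero          _         = refl
at-++ˡ (x ∷ xs) ys (suc zero)    _         = refl
at-++ˡ (x ∷ xs) ys (suc (suc m)) (s≤s m≤l) = at-++ˡ xs ys (suc m) m≤l

at-++ʳ : ∀ xs ys t → 1 ≤ t → at (xs ++ ys) (length xs + t) ≡ at ys t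
at-++ʳ []       ys t       _ = refl
at-++ʳ (x ∷ xs) ys (suc t) _ =
  trans (at-suc x (xs ++ ys) (length xs + suc t) (≤-trans (s≤s z≤n) (m≤n+m (suc t) (length xs))))
        (at-++ʳ xs ys (suc t) (s≤s z≤n))

at-++-replicate-0 : ∀ xs r m → at (xs ++ replicate r 0) m ≡ at xs m
at-++-replicate-0 []       zero    m             = refl
at-++-replicate-0 []       (suc r) zero          = refl
at-++-replicate-0 []       (suc r) (suc zero)    = refl
at-++-replicate-0 []       (suc r) (suc (suc m)) = at-++-replicate-0 [] r (suc m)
at-++-replicate-0 (x ∷ xs) r       zero          = refl
at-++-replicate-0 (x ∷ xs) r       (suc zero)    = refl
at-++-replicate-0 (x ∷ xs) r       (suc (suc m)) = at-++-replicate-0 xs r (suc m)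

at-replicate : ∀ r (x : ℕ) t → 1 ≤ t → t ≤ r → at (replicate r x) t ≡ x
at-replicate (suc r) x (suc zero)    _ _         = refl
at-replicate (suc r) x (suc (suc t)) _ (s≤s t≤r) = at-replicate r x (suc t) (s≤s z≤n) t≤r

at-map : ∀ (f : ℕ → ℕ) xs m → 1 ≤ m → m ≤ length xs → at (map f xs) m ≡ f (at xs m)
at-map f (x ∷ xs) (suc zero)    _ _         = refl
at-map f (x ∷ xs) (suc (suc m)) _ (s≤s m≤l) = at-map f xs (suc m) (s≤s z≤n) m≤l

All-at : ∀ {P : ℕ → Set} xs m → All P xs → 1 ≤ m → m ≤ length xs → P (at xs m)
All-at (x ∷ xs) (suc zero)    (px ∷ _)   _ _         = px
All-at (x ∷ xs) (suc (suc m)) (_ ∷ pxs) _ (s≤s m≤l) = All-at xs (suc m) pxs (s≤s z≤n) m≤l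

sum-take : ∀ k xs → sum (take k xs) ≡ ∑ (at xs) k
sum-take zero    xs       = refl
sum-take (suc k) []       = sym (∑-zero (suc k))
sum-take (suc k) (x ∷ xs) = begin
  x + sum (take k xs)                 ≡⟨ cong (x +_) (sum-take k xs) ⟩
  x + ∑ (at xs) k                     ≡⟨ cong (x +_) (∑-cong k (λ i i≥1 _ → sym (at-suc x xs i i≥1))) ⟩
  at (x ∷ xs) 1 + ∑ (λ i → at (x ∷ xs) (suc i)) k ≡⟨ sym (∑-+ 1 k (at (x ∷ xs))) ⟩
  ∑ (at (x ∷ xs)) (suc k)             ∎
  where open ≡-Reasoning

sum≡∑at : ∀ xs → sum xs ≡ ∑ (at xs) (length xs)
sum≡∑at xs = trans (cong sum (sym (take-all (length xs) xs ≤-refl))) (sum-take (length xs) xs)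

length-filter-χ : ∀ {P : Pred ℕ _} (P? : Decidable P) xs → length (filter P? xs) ≡ sum (map (λ x → χ (P? x)) xs)
length-filter-χ P? []       = refl
length-filter-χ P? (x ∷ xs) with P? x
... | yes _ = cong suc (length-filter-χ P? xs)
... | no _  = length-filter-χ P? xs

sum-map-filter-χ : ∀ {P : Pred ℕ _} (P? : Decidable P) (f : ℕ → ℕ) xs →
  sum (map f (filter P? xs)) ≡ sum (map (λ x → χ (P? x) * f x) xs)
sum-map-filter-χ P? f []       = refl
sum-map-filter-χ P? f (x ∷ xs) with P? x
... | yes _ = cong₂ _+_ (sym (+-identityʳ (f x))) (sum-map-filter-χ P? f xs)
... | no _  = sum-map-filter-χ P? f xs

range1-suc : ∀ n → range1 (suc n) ≡ range1 n ++ suc n ∷ []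
range1-suc n = trans (cong (map suc) (sym (applyUpTo-∷ʳ (λ x → x) n))) (map-++ suc (upTo n) (n ∷ []))

length-range1 : ∀ n → length (range1 n) ≡ n
length-range1 n = trans (length-map suc (upTo n)) (length-upTo n)

length-map-range1 : ∀ (f : ℕ → ℕ) n → length (map f (range1 n)) ≡ n
length-map-range1 f n = trans (length-map f (range1 n)) (length-range1 n)

at-range1 : ∀ n m → 1 ≤ m → m ≤ n → at (range1 n) m ≡ m
at-range1 zero    .zero () z≤n
at-range1 (suc n) m m≥1 m≤1+n with m ≤? n
... | yes m≤n = trans (cong (λ xs → at xs m) (range1-suc n))
                  (trans (at-++ˡ (range1 n) _ m (subst (m ≤_) (sym (length-range1 n)) m≤n)) (at-range1 n m m≥1 m≤n))
... | no m≰n rewrite ≤-antisym m≤1+n (≰⇒> m≰n) = trans (cong (λ xs → at xs (suc n)) (range1-suc n))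
  (subst (λ i → at (range1 n ++ suc n ∷ []) i ≡ suc n) (trans (cong (_+ 1) (length-range1 n)) (+-comm n 1))
    (at-++ʳ (range1 n) (suc n ∷ []) 1 (s≤s z≤n)))

at-map-range1 : ∀ (f : ℕ → ℕ) n m → 1 ≤ m → m ≤ n → at (map f (range1 n)) m ≡ f m
at-map-range1 f n m m≥1 m≤n =
  trans (at-map f (range1 n) m m≥1 (subst (m ≤_) (sym (length-range1 n)) m≤n)) (cong f (at-range1 n m m≥1 m≤n))

sum-map-range1 : ∀ (f : ℕ → ℕ) n → sum (map f (range1 n)) ≡ ∑ f n
sum-map-range1 f zero    = refl
sum-map-range1 f (suc n) = begin
  sum (map f (range1 (suc n)))                 ≡⟨ cong (λ xs → sum (map f xs)) (range1-suc n) ⟩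
  sum (map f (range1 n ++ suc n ∷ []))         ≡⟨ cong sum (map-++ f (range1 n) (suc n ∷ [])) ⟩
  sum (map f (range1 n) ++ f (suc n) ∷ [])     ≡⟨ sum-++ (map f (range1 n)) (f (suc n) ∷ []) ⟩
  sum (map f (range1 n)) + (f (suc n) + 0)     ≡⟨ cong₂ _+_ (sum-map-range1 f n) (+-identityʳ _) ⟩
  ∑ f n + f (suc n)                            ∎
  where open ≡-Reasoning

reverse-replicate : ∀ r (x : ℕ) → reverse (replicate r x) ≡ replicate r x
reverse-replicate zero    x = refl
reverse-replicate (suc r) x = begin
  reverse (x ∷ replicate r x)   ≡⟨ unfold-reverse x (replicate r x) ⟩
  reverse (replicate r x) ∷ʳ x  ≡⟨ cong (_∷ʳ x) (reverse-replicate r x) ⟩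
  replicate r x ∷ʳ x            ≡⟨ replicate-∷ʳ r ⟩
  x ∷ replicate r x             ∎
  where
  open ≡-Reasoning
  replicate-∷ʳ : ∀ r → replicate r x ∷ʳ x ≡ x ∷ replicate r x
  replicate-∷ʳ zero    = refl
  replicate-∷ʳ (suc r) = cong (x ∷_) (replicate-∷ʳ r)

replicate-0++dropWhile : ∀ xs → Σ ℕ λ r → xs ≡ replicate r 0 ++ dropWhile (_≟ 0) xs
replicate-0++dropWhile []           = 0 , refl
replicate-0++dropWhile (zero ∷ xs)  with replicate-0++dropWhile xs
... | r , xs≡ = suc r , cong (0 ∷_) xs≡
replicate-0++dropWhile (suc x ∷ xs) = 0 , refl

stripZeros-padding : ∀ xs → Σ ℕ λ r → xs ≡ stripZeros xs ++ replicate r 0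
stripZeros-padding xs with replicate-0++dropWhile (reverse xs)
... | r , rev-xs≡ = r , (begin
  xs                                      ≡⟨ sym (reverse-involutive xs) ⟩
  reverse (reverse xs)                    ≡⟨ cong reverse rev-xs≡ ⟩
  reverse (replicate r 0 ++ ys)           ≡⟨ reverse-++ (replicate r 0) ys ⟩
  reverse ys ++ reverse (replicate r 0)   ≡⟨ cong (reverse ys ++_) (reverse-replicate r 0) ⟩
  reverse ys ++ replicate r 0             ∎)
  where
  open ≡-Reasoning
  ys : List ℕ
  ys = dropWhile (_≟ 0) (reverse xs)

-- Row i meets exactly the diagonals i, …, reach α i (the diagram has no cells on diagonals
-- beyond sum α, which is why every sum over diagonals below stops at sum α).
reach : List ℕ → ℕ → ℕ
reach α i = at α i + i ∸ 1

diagCount : List ℕ → ℕ → ℕ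
diagCount α m = ∑ (λ i → χ (m ≤? reach α i)) m

diagCountFirst : List ℕ → ℕ → ℕ → ℕ
diagCountFirst α k m = ∑ (λ i → χ (i ≤? k) * χ (m ≤? reach α i)) m

diag≡diagCount : ∀ α m → diag α m ≡ diagCount α m
diag≡diagCount α m = trans (length-filter-χ (λ i → m ≤? reach α i) (range1 m)) (sum-map-range1 _ m)

suc-reach∸≡at : ∀ α i → 1 ≤ i → suc (reach α i) ∸ i ≡ at α i
suc-reach∸≡at α (suc i) _ rewrite +-suc (at α (suc i)) i = m+n∸n≡m (at α (suc i)) i

diagCountFirst≤diagCount : ∀ α k m → diagCountFirst α k m ≤ diagCount α m
diagCountFirst≤diagCount α k m = ∑-mono-≤ m (λ i _ _ → χ*n≤n (i ≤? k) _)

diagCountFirst≤k : ∀ α k m → diagCountFirst α k m ≤ k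
diagCountFirst≤k α k m = begin
  diagCountFirst α k m      ≤⟨ ∑-mono-≤ m (λ i _ _ → ≤-trans (*-monoʳ-≤ (χ (i ≤? k)) (χ≤1 (m ≤? reach α i)))
                                                              (≤-reflexive (*-identityʳ _))) ⟩
  ∑ (λ i → χ (i ≤? k)) m    ≡⟨ ∑-χ-≤ m k ⟩
  m ⊓ k                     ≤⟨ m⊓n≤n m k ⟩
  k                         ∎
  where open ≤-Reasoning

-- Of the m rows that may meet diagonal m, at most m ∸ k lie below row k.
diagCount≤diagCountFirst+ : ∀ α k m → diagCount α m ≤ diagCountFirst α k m + (m ∸ k)
diagCount≤diagCountFirst+ α k m = begin
  diagCount α m                                               ≤⟨ ∑-mono-≤ m split ⟩
  ∑ (λ i → χ (i ≤? k) * χ (m ≤? reach α i) + χ (suc k ≤? i)) m ≡⟨ ∑-distrib-+ m _ _ ⟩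
  diagCountFirst α k m + ∑ (λ i → χ (suc k ≤? i)) m           ≡⟨ cong (diagCountFirst α k m +_) (∑-χ-> k m) ⟩
  diagCountFirst α k m + (m ∸ k)                              ∎
  where
  open ≤-Reasoning
  split : ∀ i → 1 ≤ i → i ≤ m → χ (m ≤? reach α i) ≤ χ (i ≤? k) * χ (m ≤? reach α i) + χ (suc k ≤? i)
  split i _ _ with i ≤? k
  ... | yes _  = ≤-trans (≤-reflexive (sym (+-identityʳ _))) (m≤m+n _ _)
  ... | no i≰k = ≤-trans (χ≤1 (m ≤? reach α i))
                   (≤-trans (≤-reflexive (sym (χ-yes (suc k ≤? i) (≰⇒> i≰k)))) (m≤n+m _ _))

module _ (α : List ℕ) (positive : All (1 ≤_) α) where

  private
    at≥1 : ∀ i → 1 ≤ i → i ≤ length α → 1 ≤ at α i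
    at≥1 i i≥1 i≤l = All-at α i positive i≥1 i≤l

  length≤sum : length α ≤ sum α
  length≤sum = subst (length α ≤_) (sym (sum≡∑at α)) (n≤∑ (length α) (at α) at≥1)

  reach≤sum : ∀ i → 1 ≤ i → i ≤ length α → reach α i ≤ sum α
  reach≤sum (suc i) _ i<l rewrite +-suc (at α (suc i)) i = begin
    at α (suc i) + i                  ≤⟨ +-monoʳ-≤ (at α (suc i))
                                           (n≤∑ i (at α) (λ j j≥1 j≤i → at≥1 j j≥1 (≤-trans j≤i (<⇒≤ i<l)))) ⟩
    at α (suc i) + ∑ (at α) i         ≡⟨ +-comm (at α (suc i)) _ ⟩
    ∑ (at α) (suc i)                  ≤⟨ ∑-monoʳ-≤ (at α) i<l ⟩
    ∑ (at α) (length α)               ≡⟨ sym (sum≡∑at α) ⟩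
    sum α                             ∎
    where open ≤-Reasoning

  sum-take≡∑diagCountFirst : ∀ k → k ≤ length α → sum (take k α) ≡ ∑ (diagCountFirst α k) (sum α)
  sum-take≡∑diagCountFirst k k≤l = begin
    sum (take k α)                                  ≡⟨ sum-take k α ⟩
    ∑ (at α) k                                      ≡⟨ sym (∑-restrict k n (at α) (≤-trans k≤l length≤sum)) ⟩
    ∑ (λ i → χ (i ≤? k) * at α i) n                 ≡⟨ ∑-cong n (λ i i≥1 _ → sym (row i i≥1)) ⟩
    ∑ (λ i → ∑ (λ m → cell m i) n) n                ≡⟨ ∑-comm n n (λ i m → cell m i) ⟩
    ∑ (λ m → ∑ (cell m) n) n                        ≡⟨ ∑-cong n (λ m _ m≤n → ∑-restrict m n _ m≤n) ⟩
    ∑ (diagCountFirst α k) n                        ∎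
    where
    open ≡-Reasoning
    n : ℕ
    n = sum α
    cell : ℕ → ℕ → ℕ
    cell m i = χ (i ≤? m) * (χ (i ≤? k) * χ (m ≤? reach α i))
    row : ∀ i → 1 ≤ i → ∑ (λ m → cell m i) n ≡ χ (i ≤? k) * at α i
    row i i≥1 = begin
      ∑ (λ m → cell m i) n                                         ≡⟨ ∑-cong n (λ m _ _ → swap m) ⟩
      ∑ (λ m → χ (i ≤? k) * (χ (i ≤? m) * χ (m ≤? reach α i))) n  ≡⟨ ∑-distribˡ-* n (χ (i ≤? k)) _ ⟩
      χ (i ≤? k) * ∑ (λ m → χ (i ≤? m) * χ (m ≤? reach α i)) n    ≡⟨ in-row (i ≤? k) ⟩
      χ (i ≤? k) * at α i                                          ∎
      where
      swap : ∀ m → cell m i ≡ χ (i ≤? k) * (χ (i ≤? m) * χ (m ≤? reach α i))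
      swap m = x*[y*z]≡y*[x*z] (χ (i ≤? m)) (χ (i ≤? k)) (χ (m ≤? reach α i))
      in-row : (i≤k? : Dec (i ≤ k)) → χ i≤k? * ∑ (λ m → χ (i ≤? m) * χ (m ≤? reach α i)) n ≡ χ i≤k? * at α i
      in-row (yes i≤k) = cong (1 *_) (trans (∑-χ-interval i (reach α i) n i≥1 (reach≤sum i i≥1 (≤-trans i≤k k≤l)))
                                            (suc-reach∸≡at α i i≥1))
      in-row (no _)    = refl

  sum-take≤∑⊓diag : ∀ k → k ≤ length α → sum (take k α) ≤ ∑ (λ m → k ⊓ diag α m) (sum α)
  sum-take≤∑⊓diag k k≤l = begin
    sum (take k α)                              ≡⟨ sum-take≡∑diagCountFirst k k≤l ⟩
    ∑ (diagCountFirst α k) (sum α)              ≤⟨ ∑-mono-≤ (sum α) (λ m _ _ → ⊓-glb (diagCountFirst≤k α k m)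
                                                                                    (diagCountFirst≤diagCount α k m)) ⟩
    ∑ (λ m → k ⊓ diagCount α m) (sum α)         ≡⟨ ∑-cong (sum α) (λ m _ _ → cong (k ⊓_) (sym (diag≡diagCount α m))) ⟩
    ∑ (λ m → k ⊓ diag α m) (sum α)              ∎
    where open ≤-Reasoning

  ∑diag∸≤sum-take : ∀ k → k ≤ length α → ∑ (λ m → diag α m ∸ (m ∸ k)) (sum α) ≤ sum (take k α)
  ∑diag∸≤sum-take k k≤l = begin
    ∑ (λ m → diag α m ∸ (m ∸ k)) (sum α)        ≡⟨ ∑-cong (sum α) (λ m _ _ → cong (_∸ (m ∸ k)) (diag≡diagCount α m)) ⟩
    ∑ (λ m → diagCount α m ∸ (m ∸ k)) (sum α)   ≤⟨ ∑-mono-≤ (sum α) bound ⟩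
    ∑ (diagCountFirst α k) (sum α)              ≡⟨ sym (sum-take≡∑diagCountFirst k k≤l) ⟩
    sum (take k α)                              ∎
    where
    open ≤-Reasoning
    bound : ∀ m → 1 ≤ m → m ≤ sum α → diagCount α m ∸ (m ∸ k) ≤ diagCountFirst α k m
    bound m _ _ = ≤-trans (∸-monoˡ-≤ (m ∸ k) (diagCount≤diagCountFirst+ α k m))
                          (≤-reflexive (m+n∸n≡m (diagCountFirst α k m) (m ∸ k)))

module _ (α d : List ℕ) (δα≡d : δ α ≡ d) where

  private
    diags : List ℕ
    diags = map (diag α) (range1 (sum α))

    r : ℕ
    r = proj₁ (stripZeros-padding diags)

    diags≡d++zeros : diags ≡ d ++ replicate r 0
    diags≡d++zeros = trans (proj₂ (stripZeros-padding diags)) (cong (_++ replicate r 0) δα≡d)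

  diag≡at-δ : ∀ m → 1 ≤ m → m ≤ sum α → diag α m ≡ at d m
  diag≡at-δ m m≥1 m≤n = begin
    diag α m                    ≡⟨ sym (at-map-range1 (diag α) (sum α) m m≥1 m≤n) ⟩
    at diags m                  ≡⟨ cong (λ xs → at xs m) diags≡d++zeros ⟩
    at (d ++ replicate r 0) m   ≡⟨ at-++-replicate-0 d r m ⟩
    at d m                      ∎
    where open ≡-Reasoning

  length-δ≤sum : length d ≤ sum α
  length-δ≤sum = subst (length d ≤_) length-diags (m≤m+n (length d) r)
    where
    length-diags : length d + r ≡ sum α
    length-diags = begin
      length d + r                          ≡⟨ cong (length d +_) (sym (length-replicate r)) ⟩
      length d + length (replicate r 0)     ≡⟨ sym (length-++ d) ⟩
      length (d ++ replicate r 0)           ≡⟨ cong length (sym diags≡d++zeros) ⟩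
      length diags                          ≡⟨ length-map-range1 (diag α) (sum α) ⟩
      sum α                                 ∎
      where open ≡-Reasoning

sum-take-conj : ∀ β k → k ≤ at β 1 → sum (take k (conj β)) ≡ sum (map (k ⊓_) β)
sum-take-conj β k k≤β₁ = begin
  sum (take k (conj β))                       ≡⟨ sum-take k (conj β) ⟩
  ∑ (at (conj β)) k                           ≡⟨ ∑-cong k at-conj ⟩
  ∑ (λ i → sum (map (λ x → χ (i ≤? x)) β)) k  ≡⟨ ∑-sum-map k (λ i x → χ (i ≤? x)) β ⟩
  sum (map (λ x → ∑ (λ i → χ (i ≤? x)) k) β)  ≡⟨ cong sum (map-cong (∑-χ-≤ k) β) ⟩
  sum (map (k ⊓_) β)                          ∎
  where
  open ≡-Reasoning
  at-conj : ∀ i → 1 ≤ i → i ≤ k → at (conj β) i ≡ sum (map (λ x → χ (i ≤? x)) β)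
  at-conj i i≥1 i≤k = trans (at-map-range1 (λ j → length (filter (j ≤?_) β)) (at β 1) i i≥1 (≤-trans i≤k k≤β₁))
                            (length-filter-χ (i ≤?_) β)

module _ (s : ℕ → ℕ) where

  descent : ℕ → List ℕ
  descent q = concatMap (λ j → replicate (s j) j) (reverse (range1 q))

  descent-suc : ∀ q → descent (suc q) ≡ replicate (s (suc q)) (suc q) ++ descent q
  descent-suc q = cong (concatMap (λ j → replicate (s j) j))
    (trans (cong reverse (range1-suc q)) (reverse-++ (range1 q) (suc q ∷ [])))

  length-descent : ∀ q → length (descent q) ≡ ∑ s q
  length-descent zero    = refl
  length-descent (suc q) = begin
    length (descent (suc q))                                     ≡⟨ cong length (descent-suc q) ⟩
    length (replicate (s (suc q)) (suc q) ++ descent q)          ≡⟨ length-++ (replicate (s (suc q)) (suc q)) ⟩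
    length (replicate (s (suc q)) (suc q)) + length (descent q)  ≡⟨ cong₂ _+_ (length-replicate (s (suc q))) (length-descent q) ⟩
    s (suc q) + ∑ s q                                            ≡⟨ +-comm (s (suc q)) (∑ s q) ⟩
    ∑ s (suc q)                                                  ∎
    where open ≡-Reasoning

  at-descent-head : ∀ q t → 1 ≤ t → t ≤ s (suc q) → at (descent (suc q)) t ≡ suc q
  at-descent-head q t t≥1 t≤s = begin
    at (descent (suc q)) t                               ≡⟨ cong (λ xs → at xs t) (descent-suc q) ⟩
    at (replicate (s (suc q)) (suc q) ++ descent q) t    ≡⟨ at-++ˡ (replicate (s (suc q)) (suc q)) (descent q) t
                                                              (subst (t ≤_) (sym (length-replicate (s (suc q)) {suc q})) t≤s) ⟩
    at (replicate (s (suc q)) (suc q)) t                 ≡⟨ at-replicate (s (suc q)) (suc q) t t≥1 t≤s ⟩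
    suc q                                                ∎
    where open ≡-Reasoning

  at-descent-tail : ∀ q u → 1 ≤ u → at (descent (suc q)) (s (suc q) + u) ≡ at (descent q) u
  at-descent-tail q u u≥1 = trans (cong (λ xs → at xs (s (suc q) + u)) (descent-suc q))
    (subst (λ l → at (replicate (s (suc q)) (suc q) ++ descent q) (l + u) ≡ at (descent q) u)
           (length-replicate (s (suc q))) (at-++ʳ (replicate (s (suc q)) (suc q)) (descent q) u u≥1))

  at-descent≤ : ∀ q t → at (descent q) t ≤ q
  at-descent≤ zero    t = z≤n
  at-descent≤ (suc q) zero = subst (_≤ suc q) (sym (at-zero (descent (suc q)))) z≤n
  at-descent≤ (suc q) (suc t) with suc t ≤? s (suc q)
  ... | yes t<s = ≤-reflexive (at-descent-head q (suc t) (s≤s z≤n) t<s)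
  ... | no t≮s with ≰⇒≡+nonzero t≮s
  ... | u , t≡s+u , u≥1 = subst (λ i → at (descent (suc q)) i ≤ suc q) (sym t≡s+u)
                             (subst (_≤ suc q) (sym (at-descent-tail q u u≥1)) (m≤n⇒m≤1+n (at-descent≤ q u)))

  tailSum : ℕ → ℕ → ℕ
  tailSum q j = ∑ (λ l → χ (j ≤? l) * s l) q

  tailSum-suc : ∀ q j → j ≤ suc q → tailSum (suc q) j ≡ s (suc q) + tailSum q j
  tailSum-suc q j j≤1+q = begin
    tailSum q j + χ (j ≤? suc q) * s (suc q)  ≡⟨ cong (λ c → tailSum q j + c * s (suc q)) (χ-yes (j ≤? suc q) j≤1+q) ⟩
    tailSum q j + (s (suc q) + 0)             ≡⟨ cong (tailSum q j +_) (+-identityʳ (s (suc q))) ⟩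
    tailSum q j + s (suc q)                   ≡⟨ +-comm (tailSum q j) (s (suc q)) ⟩
    s (suc q) + tailSum q j                   ∎
    where open ≡-Reasoning

  tailSum-above : ∀ q → tailSum q (suc q) ≡ 0
  tailSum-above q = ∑-vanishes q (λ l _ l≤q → cong (_* s l) (χ-no (suc q ≤? l) (<⇒≱ (s≤s l≤q))))

  tailSum≤∑ : ∀ q j → tailSum q j ≤ ∑ s q
  tailSum≤∑ q j = ∑-mono-≤ q (λ l _ _ → χ*n≤n (j ≤? l) (s l))

  ≤at-descent⇔ : ∀ q j t → 1 ≤ j → j ≤ q → 1 ≤ t → j ≤ at (descent q) t ⇔ t ≤ tailSum q j
  ≤at-descent⇔ zero    .zero t () z≤n _
  ≤at-descent⇔ (suc q) j t j≥1 j≤1+q t≥1 with t ≤? s (suc q)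
  ... | yes t≤s = mk⇔ (λ _ → subst (t ≤_) (sym (tailSum-suc q j j≤1+q)) (m≤n⇒m≤n+o (tailSum q j) t≤s))
                      (λ _ → subst (j ≤_) (sym (at-descent-head q t t≥1 t≤s)) j≤1+q)
  ... | no t≰s with ≰⇒≡+nonzero t≰s
  ... | u , refl , u≥1 with j ≤? q
  ...   | yes j≤q = mk⇔
          (λ j≤at → subst (s (suc q) + u ≤_) (sym (tailSum-suc q j j≤1+q))
                      (+-monoʳ-≤ (s (suc q)) (to IH (subst (j ≤_) (at-descent-tail q u u≥1) j≤at))))
          (λ s+u≤ → subst (j ≤_) (sym (at-descent-tail q u u≥1))
                      (from IH (+-cancelˡ-≤ (s (suc q)) u _ (subst (s (suc q) + u ≤_) (tailSum-suc q j j≤1+q) s+u≤))))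
    where
    IH : j ≤ at (descent q) u ⇔ u ≤ tailSum q j
    IH = ≤at-descent⇔ q j u j≥1 j≤q u≥1
  ...   | no j≰q = mk⇔
          (λ j≤at → ⊥-elim (j≰q (≤-trans (subst (j ≤_) (at-descent-tail q u u≥1) j≤at) (at-descent≤ q u))))
          (λ s+u≤ → ⊥-elim (<⇒≱ (m<m+n (s (suc q)) u≥1) (subst (s (suc q) + u ≤_) tailSum≡s s+u≤)))
    where
    tailSum≡s : tailSum (suc q) j ≡ s (suc q)
    tailSum≡s rewrite ≤-antisym j≤1+q (≰⇒> j≰q) = trans (tailSum-suc q (suc q) ≤-refl)
                                                        (trans (cong (s (suc q) +_) (tailSum-above q)) (+-identityʳ _))

  at-diagForm-≤ : ∀ q m → 1 ≤ m → m ≤ q → at (diagForm q s) m ≡ m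
  at-diagForm-≤ q m m≥1 m≤q =
    trans (at-++ˡ (range1 q) (descent q) m (subst (m ≤_) (sym (length-range1 q)) m≤q)) (at-range1 q m m≥1 m≤q)

  at-diagForm-> : ∀ q t → 1 ≤ t → at (diagForm q s) (q + t) ≡ at (descent q) t
  at-diagForm-> q t t≥1 = subst (λ l → at (diagForm q s) (l + t) ≡ at (descent q) t) (length-range1 q)
    (at-++ʳ (range1 q) (descent q) t t≥1)

  length-diagForm : ∀ q → length (diagForm q s) ≡ q + ∑ s q
  length-diagForm q = trans (length-++ (range1 q)) (cong₂ _+_ (length-range1 q) (length-descent q))

  at-diagForm≤ : ∀ q m → at (diagForm q s) m ≤ q
  at-diagForm≤ q zero = subst (_≤ q) (sym (at-zero (diagForm q s))) z≤n
  at-diagForm≤ q (suc m) with suc m ≤? q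
  ... | yes m<q = subst (_≤ q) (sym (at-diagForm-≤ q (suc m) (s≤s z≤n) m<q)) m<q
  ... | no m≮q with ≰⇒≡+nonzero m≮q
  ... | t , m≡q+t , t≥1 = subst (λ i → at (diagForm q s) i ≤ q) (sym m≡q+t)
                            (subst (_≤ q) (sym (at-diagForm-> q t t≥1)) (at-descent≤ q t))

  χ-≤at-diagForm : ∀ q j m → 1 ≤ j → j ≤ q → 1 ≤ m →
    χ (j ≤? at (diagForm q s) m) ≡ χ (j ≤? m) * χ (m ≤? q + tailSum q j)
  χ-≤at-diagForm q j m j≥1 j≤q m≥1 with m ≤? q
  ... | yes m≤q = begin
    χ (j ≤? at (diagForm q s) m)           ≡⟨ cong (λ x → χ (j ≤? x)) (at-diagForm-≤ q m m≥1 m≤q) ⟩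
    χ (j ≤? m)                             ≡⟨ sym (*-identityʳ _) ⟩
    χ (j ≤? m) * 1                         ≡⟨ cong (χ (j ≤? m) *_) (sym (χ-yes (m ≤? q + tailSum q j) (m≤n⇒m≤n+o _ m≤q))) ⟩
    χ (j ≤? m) * χ (m ≤? q + tailSum q j)  ∎
    where open ≡-Reasoning
  ... | no m≰q with ≰⇒≡+nonzero m≰q
  ... | t , refl , t≥1 = begin
    χ (j ≤? at (diagForm q s) (q + t))     ≡⟨ cong (λ x → χ (j ≤? x)) (at-diagForm-> q t t≥1) ⟩
    χ (j ≤? at (descent q) t)              ≡⟨ χ-cong (j ≤? at (descent q) t) (q + t ≤? q + tailSum q j) in-descent ⟩
    χ (q + t ≤? q + tailSum q j)           ≡⟨ sym (*-identityˡ _) ⟩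
    1 * χ (q + t ≤? q + tailSum q j)       ≡⟨ cong (_* χ (q + t ≤? q + tailSum q j)) (sym (χ-yes (j ≤? q + t) (m≤n⇒m≤n+o t j≤q))) ⟩
    χ (j ≤? q + t) * χ (q + t ≤? q + tailSum q j) ∎
    where
    open ≡-Reasoning
    in-descent : j ≤ at (descent q) t ⇔ q + t ≤ q + tailSum q j
    in-descent = mk⇔ (+-monoʳ-≤ q ∘ to (≤at-descent⇔ q j t j≥1 j≤q t≥1))
                     (from (≤at-descent⇔ q j t j≥1 j≤q t≥1) ∘ +-cancelˡ-≤ q t (tailSum q j))

  alphaBarEntry : ℕ → ℕ → ℕ
  alphaBarEntry q j = q ∸ j + 1 + tailSum q j

  alphaBar≡map-alphaBarEntry : ∀ q → alphaBar q s ≡ map (alphaBarEntry q) (range1 q)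
  alphaBar≡map-alphaBarEntry q = map-cong
    (λ i → cong (q ∸ i + 1 +_) (trans (sum-map-filter-χ (i ≤?_) s (range1 q)) (sum-map-range1 _ q))) (range1 q)

  column-length : ∀ q j N → 1 ≤ j → j ≤ q → q + ∑ s q ≤ N →
    ∑ (λ m → χ (j ≤? at (diagForm q s) m)) N ≡ alphaBarEntry q j
  column-length q j N j≥1 j≤q q+∑s≤N = begin
    ∑ (λ m → χ (j ≤? at (diagForm q s) m)) N              ≡⟨ ∑-cong N (λ m m≥1 _ → χ-≤at-diagForm q j m j≥1 j≤q m≥1) ⟩
    ∑ (λ m → χ (j ≤? m) * χ (m ≤? q + tailSum q j)) N     ≡⟨ ∑-χ-interval j (q + tailSum q j) N j≥1
                                                               (≤-trans (+-monoʳ-≤ q (tailSum≤∑ q j)) q+∑s≤N) ⟩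
    suc (q + tailSum q j) ∸ j                             ≡⟨ suc[m+n]∸o≡m∸o+1+n q (tailSum q j) j j≤q ⟩
    alphaBarEntry q j                                     ∎
    where open ≡-Reasoning

  ∑⊓at-diagForm≡sum-take-alphaBar : ∀ q k N → k ≤ q → q + ∑ s q ≤ N →
    ∑ (λ m → k ⊓ at (diagForm q s) m) N ≡ sum (take k (alphaBar q s))
  ∑⊓at-diagForm≡sum-take-alphaBar q k N k≤q q+∑s≤N = begin
    ∑ (λ m → k ⊓ at D m) N                           ≡⟨ ∑-cong N (λ m _ _ → sym (∑-χ-≤ k (at D m))) ⟩
    ∑ (λ m → ∑ (λ j → χ (j ≤? at D m)) k) N          ≡⟨ ∑-comm N k (λ m j → χ (j ≤? at D m)) ⟩
    ∑ (λ j → ∑ (λ m → χ (j ≤? at D m)) N) k          ≡⟨ ∑-cong k (λ j j≥1 j≤k → column-length q j N j≥1 (≤-trans j≤k k≤q) q+∑s≤N) ⟩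
    ∑ (alphaBarEntry q) k                            ≡⟨ ∑-cong k (λ j j≥1 j≤k → sym (at-alphaBar j j≥1 (≤-trans j≤k k≤q))) ⟩
    ∑ (at (alphaBar q s)) k                          ≡⟨ sym (sum-take k (alphaBar q s)) ⟩
    sum (take k (alphaBar q s))                      ∎
    where
    open ≡-Reasoning
    D : List ℕ
    D = diagForm q s
    at-alphaBar : ∀ j → 1 ≤ j → j ≤ q → at (alphaBar q s) j ≡ alphaBarEntry q j
    at-alphaBar j j≥1 j≤q = trans (cong (λ xs → at xs j) (alphaBar≡map-alphaBarEntry q))
                                  (at-map-range1 (alphaBarEntry q) q j j≥1 j≤q)

  ∑at-diagForm∸≡∑⊓alphaBarEntry : ∀ q k N → q + ∑ s q ≤ N →
    ∑ (λ m → at (diagForm q s) m ∸ (m ∸ k)) N ≡ ∑ (λ j → k ⊓ alphaBarEntry q j) q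
  ∑at-diagForm∸≡∑⊓alphaBarEntry q k N q+∑s≤N = begin
    ∑ (λ m → at D m ∸ (m ∸ k)) N                                   ≡⟨ ∑-cong N (λ m _ _ → sym (rows m)) ⟩
    ∑ (λ m → ∑ (λ j → χ (suc (m ∸ k) ≤? j) * χ (j ≤? at D m)) q) N ≡⟨ ∑-comm N q _ ⟩
    ∑ (λ j → ∑ (λ m → χ (suc (m ∸ k) ≤? j) * χ (j ≤? at D m)) N) q ≡⟨ ∑-cong q column ⟩
    ∑ (λ j → k ⊓ alphaBarEntry q j) q                              ∎
    where
    open ≡-Reasoning
    D : List ℕ
    D = diagForm q s
    rows : ∀ m → ∑ (λ j → χ (suc (m ∸ k) ≤? j) * χ (j ≤? at D m)) q ≡ at D m ∸ (m ∸ k)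
    rows m = ∑-χ-interval (suc (m ∸ k)) (at D m) q (s≤s z≤n) (at-diagForm≤ q m)
    column : ∀ j → 1 ≤ j → j ≤ q → ∑ (λ m → χ (suc (m ∸ k) ≤? j) * χ (j ≤? at D m)) N ≡ k ⊓ alphaBarEntry q j
    column (suc j) j≥1 j≤q = begin
      ∑ (λ m → χ (suc (m ∸ k) ≤? suc j) * χ (suc j ≤? at D m)) N
        ≡⟨ ∑-cong N (λ m m≥1 _ → cong (χ (suc (m ∸ k) ≤? suc j) *_) (χ-≤at-diagForm q (suc j) m j≥1 j≤q m≥1)) ⟩
      ∑ (λ m → χ (suc (m ∸ k) ≤? suc j) * (χ (suc j ≤? m) * χ (m ≤? q + tailSum q (suc j)))) N
        ≡⟨ ∑-χ-window j k (q + tailSum q (suc j)) N (≤-trans (+-monoʳ-≤ q (tailSum≤∑ q (suc j))) q+∑s≤N) ⟩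
      k ⊓ (q + tailSum q (suc j) ∸ j)
        ≡⟨ cong (k ⊓_) (suc[m+n]∸o≡m∸o+1+n q (tailSum q (suc j)) (suc j) j≤q) ⟩
      k ⊓ alphaBarEntry q (suc j)
        ∎

  sum-map-⊓-alphaBar : ∀ q k → sum (map (k ⊓_) (alphaBar q s)) ≡ ∑ (λ j → k ⊓ alphaBarEntry q j) q
  sum-map-⊓-alphaBar q k = begin
    sum (map (k ⊓_) (alphaBar q s))                        ≡⟨ cong (λ xs → sum (map (k ⊓_) xs)) (alphaBar≡map-alphaBarEntry q) ⟩
    sum (map (k ⊓_) (map (alphaBarEntry q) (range1 q)))    ≡⟨ cong sum (sym (map-∘ (range1 q))) ⟩
    sum (map (λ j → k ⊓ alphaBarEntry q j) (range1 q))     ≡⟨ sum-map-range1 _ q ⟩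
    ∑ (λ j → k ⊓ alphaBarEntry q j) q                      ∎
    where open ≡-Reasoning

module _ (q : ℕ) (s : ℕ → ℕ) (α : List ℕ) (positive : All (1 ≤_) α) (δα≡D : δ α ≡ diagForm q s) where

  private
    D : List ℕ
    D = diagForm q s

    N : ℕ
    N = sum α

    q+∑s≤N : q + ∑ s q ≤ N
    q+∑s≤N = subst (_≤ N) (length-diagForm s q) (length-δ≤sum α D δα≡D)

    ∑-diag≡∑-at : (f : ℕ → ℕ → ℕ) → ∑ (λ m → f m (diag α m)) N ≡ ∑ (λ m → f m (at D m)) N
    ∑-diag≡∑-at f = ∑-cong N (λ m m≥1 m≤N → cong (f m) (diag≡at-δ α D δα≡D m m≥1 m≤N))

  alphaBar≻ : alphaBar q s ≻ α
  alphaBar≻ k k≤ = begin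
    sum (take k α)                  ≤⟨ sum-take≤∑⊓diag α positive k (≤-trans k≤ (m⊓n≤n _ _)) ⟩
    ∑ (λ m → k ⊓ diag α m) N        ≡⟨ ∑-diag≡∑-at (λ _ d → k ⊓ d) ⟩
    ∑ (λ m → k ⊓ at D m) N          ≡⟨ ∑⊓at-diagForm≡sum-take-alphaBar s q k N
                                         (subst (k ≤_) (length-map-range1 _ q) (≤-trans k≤ (m⊓n≤m _ _))) q+∑s≤N ⟩
    sum (take k (alphaBar q s))     ∎
    where open ≤-Reasoning

  ≻conj-alphaBar : α ≻ conj (alphaBar q s)
  ≻conj-alphaBar k k≤ = begin
    sum (take k (conj (alphaBar q s)))      ≡⟨ sum-take-conj (alphaBar q s) k
                                                 (subst (k ≤_) (length-map-range1 _ _) (≤-trans k≤ (m⊓n≤n _ _))) ⟩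
    sum (map (k ⊓_) (alphaBar q s))         ≡⟨ sum-map-⊓-alphaBar s q k ⟩
    ∑ (λ j → k ⊓ alphaBarEntry s q j) q     ≡⟨ sym (∑at-diagForm∸≡∑⊓alphaBarEntry s q k N q+∑s≤N) ⟩
    ∑ (λ m → at D m ∸ (m ∸ k)) N            ≡⟨ sym (∑-diag≡∑-at (λ m d → d ∸ (m ∸ k))) ⟩
    ∑ (λ m → diag α m ∸ (m ∸ k)) N          ≤⟨ ∑diag∸≤sum-take α positive k (≤-trans k≤ (m⊓n≤m _ _)) ⟩
    sum (take k α)                          ∎
    where open ≤-Reasoning

proposition3p1 : (n : ℕ) → 1 ≤ n → (q : ℕ) → 1 ≤ q → (s : ℕ → ℕ)
    → diagForm q s ∈Δ n
    → (α : List ℕ) → IsPartition n α → δ α ≡ diagForm q s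
    → (alphaBar q s ≻ α) × (α ≻ conj (alphaBar q s))
proposition3p1 _ _ q _ s _ α (_ , positive , _) δα≡D =
  alphaBar≻ q s α positive δα≡D , ≻conj-alphaBar q s α positive δα≡D
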